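{- Let $f:\mathcal{C}\to\mathcal{D}$ and $g:\mathcal{D}\to\mathcal{E}$ be chromatic simplicial maps between chromatic simplicial complexes coloured by a finite nonempty set of agents $A$. Then $\kappa(g\circ f)=\kappa(g)\circ\kappa(f)$.
   Context: A chromatic simplicial complex coloured by $A$ is $\langle V,S,\chi\rangle$ where $S$ is a family of nonempty subsets of $V$ containing all singletons and closed under nonempty subsets, and $\chi:V\to A$ gives distinct colours to vertices of each simplex; $\mathcal{F}(\mathcal{C})$ is its set of facets (maximal simplexes). Chromatic simplicial maps are vertex maps preserving simplexes and colours. $\kappa(\mathcal{C})$ is the partial epistemic frame with worlds $\mathcal{F}(\mathcal{C})$ and $X\sim_a Y$ iff $a\in\chi(X\cap Y)$; for a chromatic simplicial map $f$, $\kappa(f)(X)=\{Z\in\mathcal{F}(\mathcal{D})\mid f(X)\subseteq Z\}$. In a partial epistemic frame (each $\sim_a$ symmetric and transitive), $\mathrm{live}(w)=\{a\mid w\sim_a w\}$ and $\mathrm{sat}_U(w)=\{w'\mid w\sim_a w'\ \forall a\in U\}$. Morphisms of partial epistemic frames are maps $h:W\to\mathcal{P}(W')$ preserving indistinguishability ($u\sim_a v$ implies $u'\sim'_a v'$ for all $u'\in h(u),v'\in h(v)$) and saturated (each $h(u)=\mathrm{sat}_{\mathrm{live}(u)}(u')$ for some $u'\in h(u)$). The composite of morphisms $h_1:M\to N$, $h_2:N\to P$ is $(h_2\circ h_1)(u)=\mathrm{sat}_{\mathrm{live}(u)}(w)$ (computed in $P$) for any $v\in h_1(u)$ and $w\in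 h_2(v)$. -}

module Defs where

open import Level using (Level; 0ℓ) renaming (suc to lsuc)
open import Data.Nat using (ℕ)
open import Data.Fin using (Fin)
open import Data.Product using (Σ; ∃; _×_; _,_; proj₁; proj₂)
open import Relation.Binary.PropositionalEquality using (_≡_)

Subset : Set → Set₁
Subset V = V → Set

_∈_ : {V : Set} → V → Subset V → Set
v ∈ X = X v

_⊆_ : {V : Set} → Subset V → Subset V → Set
X ⊆ Y = ∀ v → X v → Y v

NonEmpty : {V : Set} → Subset V → Set
NonEmpty X = ∃ λ v → X v

singleton : {V : Set} → V → Subset V
singleton v = λ w → w ≡ v

image : {V W : Set} → (V → W) → Subset V → Subset W
image f X = λ w → ∃ λ v → X v × f v ≡ w

record ChromaticComplex (A : Set) : Set₁ where
  field
    V          : Set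
    S          : Subset V → Set
    S-nonempty : ∀ X → S X → NonEmpty X
    S-singleton : ∀ v → S (singleton v)
    S-down     : ∀ X Y → S X → Y ⊆ X → NonEmpty Y → S Y
    χ          : V → A
    χ-chromatic : ∀ X → S X → ∀ u v → X u → X v → χ u ≡ χ v → u ≡ v

open ChromaticComplex public

IsFacet : {A : Set} (C : ChromaticComplex A) → Subset (V C) → Set₁
IsFacet C X = S C X × (∀ Y → S C Y → X ⊆ Y → Y ⊆ X)

Facet : {A : Set} → ChromaticComplex A → Set₁
Facet C = Σ (Subset (V C)) (IsFacet C)

record ChromaticMap {A : Set} (C D : ChromaticComplex A) : Set₁ where
  field
    fun       : V C → V D
    simplicial : ∀ X → S C X → S D (image fun X)
    chromatic : ∀ v → χ D (fun v) ≡ χ C v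

open ChromaticMap public

_∘ᶜ_ : {A : Set} {C D E : ChromaticComplex A} →
       ChromaticMap D E → ChromaticMap C D → ChromaticMap C E
_∘ᶜ_ {A} {C} {D} {E} g f = record
  { fun = λ v → fun g (fun f v)
  ; simplicial = λ X sX →
      S-down E (image (fun g) (image (fun f) X)) (image (λ v → fun g (fun f v)) X)
        (simplicial g _ (simplicial f X sX))
        (λ w → λ { (v , Xv , eq) → fun f v , (v , Xv , _≡_.refl) , eq })
        (image-ne X (S-nonempty C X sX))
  ; chromatic = λ v → trans' (chromatic g (fun f v)) (chromatic f v)
  }
  where
    image-ne : ∀ X → NonEmpty X → NonEmpty (image (λ v → fun g (fun f v)) X)
    image-ne X (v , Xv) = fun g (fun f v) , v , Xv , _≡_.refl
    trans' : ∀ {a b c : A} → a ≡ b → b ≡ c → a ≡ c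
    trans' _≡_.refl q = q

-- Partial epistemic frames (worlds in Set₁, since they are facets)

record PFrame (A : Set) : Set₂ where
  field
    World : Set₁
    _∼[_]_ : World → A → World → Set

open PFrame public

live : {A : Set} (M : PFrame A) → World M → A → Set
live M w a = _∼[_]_ M w a w

sat : {A : Set} (M : PFrame A) → (A → Set) → World M → World M → Set
sat M U w w' = ∀ a → U a → _∼[_]_ M w a w'

FrameMap : {A : Set} → PFrame A → PFrame A → Set₁
FrameMap M N = World M → World N → Set

-- composite (h₂ ∘ h₁)(u) = sat_{live(u)}(w), computed in P, for the chosen
-- v ∈ h₁(u) and w ∈ h₂(v).  The witnesses v, w are passed explicitly.
composite : {A : Set} (M N P : PFrame A) (h₁ : FrameMap M N) (h₂ : FrameMap N P)
            (u : World M) (v : World N) → h₁ u v → (w : World P) → h₂ v w →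
            World P → Set
composite M N P h₁ h₂ u v _ w _ = sat P (live M u) w

κ : {A : Set} → ChromaticComplex A → PFrame A
κ C = record
  { World = Facet C
  ; _∼[_]_ = λ X a Y → ∃ λ v → proj₁ X v × proj₁ Y v × χ C v ≡ a
  }

κmap : {A : Set} {C D : ChromaticComplex A} → ChromaticMap C D → FrameMap (κ C) (κ D)
κmap f X Z = image (fun f) (proj₁ X) ⊆ proj₁ Z

Agents : ℕ → Set
Agents n = Fin (ℕ.suc n)

-- κ(h)(X) consists of the facets containing h(X), and for any one such facet Z it is
-- exactly sat_{live(X)}(Z): a facet W agrees with Z on every colour of X precisely when
-- it contains h(X), because h preserves colours and Z has at most one vertex of each
-- colour. Since Z ∈ κ(g)(Y) with Y ∈ κ(f)(X) gives Z ∈ κ(g ∘ f)(X), the composite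
-- sat_{live(X)}(Z) is κ(g ∘ f)(X).
module Submission where

open import Defs
open import Data.Nat using (ℕ)
open import Data.Product using (_,_; proj₁; proj₂)
open import Function.Bundles using (_⇔_; mk⇔)
open import Relation.Binary.PropositionalEquality using (_≡_; refl; sym; trans; subst)

module _ {A : Set} {C D E : ChromaticComplex A} where

  κmap-∘ : (f : ChromaticMap C D) (g : ChromaticMap D E)
           {X : Facet C} {Y : Facet D} {Z : Facet E} →
           κmap f X Y → κmap g Y Z → κmap (g ∘ᶜ f) X Z
  κmap-∘ f g Y⊇fX Z⊇gY w (v , Xv , refl) = Z⊇gY w (fun f v , Y⊇fX (fun f v) (v , Xv , refl) , refl)

module _ {A : Set} {C E : ChromaticComplex A} (h : ChromaticMap C E)
         (X : Facet C) (Z : Facet E) (Z⊇hX : κmap h X Z) where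

  κmap⇒sat : (W : Facet E) → κmap h X W → sat (κ E) (live (κ C) X) Z W
  κmap⇒sat W W⊇hX a (v , Xv , _ , χv≡a) =
    fun h v , Z⊇hX _ (v , Xv , refl) , W⊇hX _ (v , Xv , refl) , trans (chromatic h v) χv≡a

  sat⇒κmap : (W : Facet E) → sat (κ E) (live (κ C) X) Z W → κmap h X W
  sat⇒κmap W W∼Z w (v , Xv , refl) with W∼Z (χ C v) (v , Xv , Xv , refl)
  ... | u , Zu , Wu , χu≡χv = subst (proj₁ W) u≡hv Wu
    where
      u≡hv : u ≡ fun h v
      u≡hv = χ-chromatic E (proj₁ Z) (proj₁ (proj₂ Z)) u (fun h v) Zu
               (Z⊇hX _ (v , Xv , refl)) (trans χu≡χv (sym (chromatic h v)))

  κmap-saturated : (W : Facet E) → κmap h X W ⇔ sat (κ E) (live (κ C) X) Z W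
  κmap-saturated W = mk⇔ (κmap⇒sat W) (sat⇒κmap W)

proposition19 : (n : ℕ) {C D E : ChromaticComplex (Agents n)}
    (f : ChromaticMap C D) (g : ChromaticMap D E) →
    (X : Facet C) (Y : Facet D) (y∈ : κmap f X Y) (Z : Facet E) (z∈ : κmap g Y Z) →
    (W : Facet E) →
    κmap (g ∘ᶜ f) X W ⇔ composite (κ C) (κ D) (κ E) (κmap f) (κmap g) X Y y∈ Z z∈ W
proposition19 _ f g X Y y∈ Z z∈ = κmap-saturated (g ∘ᶜ f) X Z (κmap-∘ f g {X} {Y} {Z} y∈ z∈)
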